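{- Let $\mathcal{D}$ be the set of all Dyck paths, and for $D\in\mathcal{D}$ let $|D|$ be its semilength and $\mathrm{svw}(D)$ the sum of the weights of its symmetric valleys. Then $$\sum_{D\in\mathcal{D}}\mathrm{svw}(D)z^{|D|}=\frac{2z^2}{1-3z-3z^2-4z^3+(1-z-3z^2)\sqrt{1-4z}}.$$
   Context: A Dyck path of semilength $n$ is a lattice path with steps $\mathbf{u}=(1,1)$ and $\mathbf{d}=(1,-1)$ from $(0,0)$ to $(2n,0)$ never going below the $x$-axis. A valley is an occurrence of consecutive steps $\mathbf{du}$. Every valley is contained in a unique maximal consecutive subsequence of the form $\mathbf{d}^i\mathbf{u}^j$ ($i,j\ge1$); the valley is symmetric if $i=j$, and in that case its weight is $i$. -}

module Defs where

open import Data.Bool using (Bool; true; false; if_then_else_; _∧_)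
open import Data.Nat using (ℕ; zero; suc; _+_; _*_; _∸_; _≡ᵇ_)
open import Data.Integer as ℤ using (ℤ; +_)
open import Data.List using (List; []; _∷_; map; concatMap; filterᵇ; upTo)
open import Data.Nat.ListAction using (sum)
open import Data.Product using (_×_; _,_)

-- Steps of a lattice path: U = (1,1), D = (1,-1).
data Step : Set where
  U D : Step

sameStep : Step → Step → Bool
sameStep U U = true
sameStep D D = true
sameStep _ _ = false

isDyckFrom : ℕ → List Step → Bool
isDyckFrom h [] = h ≡ᵇ 0
isDyckFrom h (U ∷ xs) = isDyckFrom (suc h) xs
isDyckFrom zero (D ∷ xs) = false
isDyckFrom (suc h) (D ∷ xs) = isDyckFrom h xs

isDyck : List Step → Bool
isDyck = isDyckFrom 0

words : ℕ → List (List Step)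
words zero = [] ∷ []
words (suc k) = concatMap (λ w → (U ∷ w) ∷ (D ∷ w) ∷ []) (words k)

dyckPaths : ℕ → List (List Step)
dyckPaths n = filterᵇ isDyck (words (2 * n))

rle : List Step → List (Step × ℕ)
rle [] = []
rle (s ∷ xs) = push (rle xs)
  where
  push : List (Step × ℕ) → List (Step × ℕ)
  push [] = (s , 1) ∷ []
  push ((t , k) ∷ rs) =
    if sameStep s t then (t , suc k) ∷ rs else (s , 1) ∷ (t , k) ∷ rs

-- Each valley du lies in a unique maximal block d^i u^j, i.e. a D-run of
-- length i immediately followed by a U-run of length j.  It is symmetric
-- iff i = j, with weight i.
svwRuns : List (Step × ℕ) → ℕ
svwRuns [] = 0
svwRuns ((D , i) ∷ (U , j) ∷ rs) =
  (if i ≡ᵇ j then i else 0) + svwRuns ((U , j) ∷ rs)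
svwRuns (_ ∷ rs) = svwRuns rs

svw : List Step → ℕ
svw p = svwRuns (rle p)

-- Formal power series with integer coefficients: n ↦ coefficient of z^n.
Series : Set
Series = ℕ → ℤ

sumℤ : List ℤ → ℤ
sumℤ [] = + 0
sumℤ (x ∷ xs) = x ℤ.+ sumℤ xs

infixl 7 _⊛_
_⊛_ : Series → Series → Series
(a ⊛ b) n = sumℤ (map (λ k → a k ℤ.* b (n ∸ k)) (upTo (suc n)))

infixl 6 _⊕_
_⊕_ : Series → Series → Series
(a ⊕ b) n = a n ℤ.+ b n

poly : List ℤ → Series
poly [] n = + 0
poly (c ∷ cs) zero = c
poly (c ∷ cs) (suc n) = poly cs n

SVW : Series
SVW n = + sum (map svw (dyckPaths n))

-- Splitting a Dyck path at its first return, U x D y, keeps the symmetric valleys of x and of y and creates one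
-- new valley D^(1+t) U^l, where t counts the trailing down steps of x and l the leading up steps of y; it is
-- symmetric iff l = 1 + t. Hence SVW = z (2 C SVW + M₁), where C is the Catalan series and M₁ sums 1 + t over
-- the pairs (x, y) with l = 1 + t. Splitting x at its last return and y at its first return gives linear
-- recurrences for M₁ and for the number K₁ of such pairs, solved by K₁ = w / (1 − w²) and M₁ = w / (1 − w²)²
-- with w = zC. Since w = z + w², the series 1 − 2w is the square root of 1 − 4z and z = w (1 − w), so the
-- claimed identity becomes a polynomial identity in w.

module Submission where

open import Algebra.Bundles using (CommutativeRing)
import Algebra.Construct.Pointwise as Pointwise
open import Algebra.Solver.Ring.AlmostCommutativeRing using (fromCommutativeRing; _-Raw-AlmostCommutative⟶_)
import Algebra.Solver.Ring as RingSolver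
open import Data.Bool using (Bool; true; false; if_then_else_; not)
open import Data.Bool.Properties using (not-involutive)
open import Data.Integer as ℤ using (ℤ; +_; -[1+_]; 0ℤ; 1ℤ; _+_; _*_; -_)
import Data.Integer.Properties as ℤ
open import Algebra.Properties.CommutativeSemigroup ℤ.+-commutativeSemigroup using (interchange)
open import Data.List using (List; []; _∷_; _++_; map; applyUpTo; concatMap; filterᵇ)
open import Data.List.Properties using (++-assoc)
open import Data.Maybe using (Maybe; just; nothing)
open import Data.Nat as ℕ using (ℕ; zero; suc; _∸_; _≡ᵇ_; z≤n; s≤s)
open import Data.Nat.Induction using (<-rec)
open import Data.Nat.ListAction using (sum)
import Data.Nat.Properties as ℕ
open import Data.Product using (_×_; _,_)
open import Data.Sum using (inj₁; inj₂)
open import Function using (_∘_)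
open import Relation.Binary.PropositionalEquality
import Relation.Binary.Reasoning.Setoid
open import Relation.Nullary using (yes; no; contradiction)

open import Defs

-- Finite sums

∑< : ℕ → (ℕ → ℤ) → ℤ
∑< zero    f = 0ℤ
∑< (suc n) f = f 0 + ∑< n (f ∘ suc)

infixl 10 ∑<
syntax ∑< n (λ i → e) = ∑[ i < n ] e

∑<-cong : ∀ n {f g : ℕ → ℤ} → (∀ i → i ℕ.< n → f i ≡ g i) → ∑< n f ≡ ∑< n g
∑<-cong zero    f≡g = refl
∑<-cong (suc n) f≡g = cong₂ _+_ (f≡g 0 (s≤s z≤n)) (∑<-cong n (λ i i<n → f≡g (suc i) (s≤s i<n)))

∑<-zero : ∀ n → ∑[ i < n ] 0ℤ ≡ 0ℤ
∑<-zero zero    = refl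
∑<-zero (suc n) = trans (ℤ.+-identityˡ _) (∑<-zero n)

∑<-distrib-+ : ∀ n (f g : ℕ → ℤ) → ∑[ i < n ] (f i + g i) ≡ ∑< n f + ∑< n g
∑<-distrib-+ zero    f g = refl
∑<-distrib-+ (suc n) f g
  rewrite ∑<-distrib-+ n (f ∘ suc) (g ∘ suc) = interchange (f 0) (g 0) _ _

∑<-*ˡ : ∀ n c (f : ℕ → ℤ) → ∑[ i < n ] (c * f i) ≡ c * ∑< n f
∑<-*ˡ zero    c f = sym (ℤ.*-zeroʳ c)
∑<-*ˡ (suc n) c f
  rewrite ∑<-*ˡ n c (f ∘ suc) = sym (ℤ.*-distribˡ-+ c (f 0) _)

∑<-*ʳ : ∀ n c (f : ℕ → ℤ) → ∑[ i < n ] (f i * c) ≡ ∑< n f * c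
∑<-*ʳ n c f = begin
  ∑[ i < n ] (f i * c)  ≡⟨ ∑<-cong n (λ i _ → ℤ.*-comm (f i) c) ⟩
  ∑[ i < n ] (c * f i)  ≡⟨ ∑<-*ˡ n c f ⟩
  c * ∑< n f            ≡⟨ ℤ.*-comm c (∑< n f) ⟩
  ∑< n f * c            ∎
  where open ≡-Reasoning

∑<-suc : ∀ n (f : ℕ → ℤ) → ∑< (suc n) f ≡ ∑< n f + f n
∑<-suc zero    f = ℤ.+-comm (f 0) 0ℤ
∑<-suc (suc n) f
  rewrite ∑<-suc n (f ∘ suc) = sym (ℤ.+-assoc (f 0) _ _)

∑<-only-last : ∀ n (f : ℕ → ℤ) → (∀ i → i ℕ.< n → f i ≡ 0ℤ) → ∑< (suc n) f ≡ f n
∑<-only-last n f f≡0 = begin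
  ∑< (suc n) f  ≡⟨ ∑<-suc n f ⟩
  ∑< n f + f n  ≡⟨ cong (_+ f n) (trans (∑<-cong n f≡0) (∑<-zero n)) ⟩
  0ℤ + f n      ≡⟨ ℤ.+-identityˡ (f n) ⟩
  f n           ∎
  where open ≡-Reasoning

∑⁺ : ℕ → (ℕ → ℕ → ℤ) → ℤ
∑⁺ n F = ∑[ i < suc n ] F i (n ∸ i)

infixl 10 ∑⁺
syntax ∑⁺ n (λ i j → e) = ∑[ i + j ≡ n ] e

∑⁺-cong : ∀ n {F G : ℕ → ℕ → ℤ} → (∀ i j → F i j ≡ G i j) → ∑⁺ n F ≡ ∑⁺ n G
∑⁺-cong n F≡G = ∑<-cong (suc n) (λ i _ → F≡G i (n ∸ i))

∑⁺-cong-≤ : ∀ n {F G : ℕ → ℕ → ℤ} → (∀ i j → j ℕ.≤ n → F i j ≡ G i j) → ∑⁺ n F ≡ ∑⁺ n G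
∑⁺-cong-≤ n F≡G = ∑<-cong (suc n) (λ i _ → F≡G i (n ∸ i) (ℕ.m∸n≤m n i))

∑⁺-zero : ∀ n → ∑[ i + j ≡ n ] 0ℤ ≡ 0ℤ
∑⁺-zero n = ∑<-zero (suc n)

∑⁺-distrib-+ : ∀ n (F G : ℕ → ℕ → ℤ) → ∑[ i + j ≡ n ] (F i j + G i j) ≡ ∑⁺ n F + ∑⁺ n G
∑⁺-distrib-+ n F G = ∑<-distrib-+ (suc n) (λ i → F i (n ∸ i)) (λ i → G i (n ∸ i))

∑⁺-*ˡ : ∀ n c (F : ℕ → ℕ → ℤ) → ∑[ i + j ≡ n ] (c * F i j) ≡ c * ∑⁺ n F
∑⁺-*ˡ n c F = ∑<-*ˡ (suc n) c (λ i → F i (n ∸ i))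

∑⁺-*ʳ : ∀ n c (F : ℕ → ℕ → ℤ) → ∑[ i + j ≡ n ] (F i j * c) ≡ ∑⁺ n F * c
∑⁺-*ʳ n c F = ∑<-*ʳ (suc n) c (λ i → F i (n ∸ i))

∑⁺-suc-last : ∀ n (F : ℕ → ℕ → ℤ) → ∑⁺ (suc n) F ≡ ∑[ i + j ≡ n ] F i (suc j) + F (suc n) 0
∑⁺-suc-last n F = begin
  ∑⁺ (suc n) F
    ≡⟨ ∑<-suc (suc n) (λ i → F i (suc n ∸ i)) ⟩
  ∑[ i < suc n ] F i (suc n ∸ i) + F (suc n) (n ∸ n)
    ≡⟨ cong₂ _+_ (∑<-cong (suc n) suc-∸) (cong (F (suc n)) (ℕ.n∸n≡0 n)) ⟩
  ∑[ i + j ≡ n ] F i (suc j) + F (suc n) 0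
    ∎
  where
  open ≡-Reasoning
  suc-∸ : ∀ i → i ℕ.< suc n → F i (suc n ∸ i) ≡ F i (suc (n ∸ i))
  suc-∸ i i<1+n = cong (F i) (ℕ.+-∸-assoc 1 (ℕ.≤-pred i<1+n))

∑⁺-comm : ∀ n (F : ℕ → ℕ → ℤ) → ∑[ i + j ≡ n ] F i j ≡ ∑[ i + j ≡ n ] F j i
∑⁺-comm zero    F = refl
∑⁺-comm (suc n) F = begin
  F 0 (suc n) + ∑[ i + j ≡ n ] F (suc i) j   ≡⟨ cong (λ t → F 0 (suc n) + t) (∑⁺-comm n (λ i j → F (suc i) j)) ⟩
  F 0 (suc n) + ∑[ i + j ≡ n ] F (suc j) i   ≡⟨ ℤ.+-comm (F 0 (suc n)) _ ⟩
  ∑[ i + j ≡ n ] F (suc j) i + F 0 (suc n)   ≡⟨ ∑⁺-suc-last n (λ i j → F j i) ⟨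
  ∑[ i + j ≡ suc n ] F j i                   ∎
  where open ≡-Reasoning

∑⁺-assoc : ∀ n (H : ℕ → ℕ → ℕ → ℤ) →
  ∑[ m + k ≡ n ] ∑[ i + j ≡ m ] H i j k ≡ ∑[ i + m ≡ n ] ∑[ j + k ≡ m ] H i j k
∑⁺-assoc zero    H = refl
∑⁺-assoc (suc n) H = begin
  (H 0 0 (suc n) + 0ℤ) + ∑[ m + k ≡ n ] (H₀ m k + ∑[ i + j ≡ m ] H (suc i) j k)
    ≡⟨ cong₂ _+_ (ℤ.+-identityʳ (H 0 0 (suc n))) (∑⁺-distrib-+ n H₀ (λ m k → ∑[ i + j ≡ m ] H (suc i) j k)) ⟩
  H 0 0 (suc n) + (∑⁺ n H₀ + ∑[ m + k ≡ n ] ∑[ i + j ≡ m ] H (suc i) j k)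
    ≡⟨ cong (λ t → H 0 0 (suc n) + (∑⁺ n H₀ + t)) (∑⁺-assoc n (H ∘ suc)) ⟩
  H 0 0 (suc n) + (∑⁺ n H₀ + ∑[ i + m ≡ n ] ∑[ j + k ≡ m ] H (suc i) j k)
    ≡⟨ ℤ.+-assoc (H 0 0 (suc n)) (∑⁺ n H₀) (∑[ i + m ≡ n ] ∑[ j + k ≡ m ] H (suc i) j k) ⟨
  H 0 0 (suc n) + ∑⁺ n H₀ + ∑[ i + m ≡ n ] ∑[ j + k ≡ m ] H (suc i) j k
    ∎
  where
  open ≡-Reasoning
  H₀ : ℕ → ℕ → ℤ
  H₀ m k = H 0 (suc m) k

-- The ring ℤ[[z]] of formal power series

infix 4 _≈_
_≈_ : Series → Series → Set
a ≈ b = ∀ n → a n ≡ b n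

cst : ℤ → Series
cst c zero    = c
cst c (suc n) = 0ℤ

neg : Series → Series
neg a n = - a n

⊛-as-∑⁺ : ∀ a b n → (a ⊛ b) n ≡ ∑[ i + j ≡ n ] (a i * b j)
⊛-as-∑⁺ a b n = sumℤ-applyUpTo (suc n) (λ i → i)
  where
  sumℤ-applyUpTo : ∀ m (f : ℕ → ℕ) →
    sumℤ (map (λ k → a k * b (n ∸ k)) (applyUpTo f m)) ≡ ∑[ i < m ] (a (f i) * b (n ∸ f i))
  sumℤ-applyUpTo zero    f = refl
  sumℤ-applyUpTo (suc m) f = cong (λ t → a (f 0) * b (n ∸ f 0) + t) (sumℤ-applyUpTo m (f ∘ suc))

⊛-cong : ∀ {a a′ b b′} → a ≈ a′ → b ≈ b′ → a ⊛ b ≈ a′ ⊛ b′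
⊛-cong {a} {a′} {b} {b′} a≈a′ b≈b′ n = begin
  (a ⊛ b) n                     ≡⟨ ⊛-as-∑⁺ a b n ⟩
  ∑[ i + j ≡ n ] (a i * b j)    ≡⟨ ∑⁺-cong n (λ i j → cong₂ _*_ (a≈a′ i) (b≈b′ j)) ⟩
  ∑[ i + j ≡ n ] (a′ i * b′ j)  ≡⟨ ⊛-as-∑⁺ a′ b′ n ⟨
  (a′ ⊛ b′) n                   ∎
  where open ≡-Reasoning

⊛-comm : ∀ a b → a ⊛ b ≈ b ⊛ a
⊛-comm a b n = begin
  (a ⊛ b) n                   ≡⟨ ⊛-as-∑⁺ a b n ⟩
  ∑[ i + j ≡ n ] (a i * b j)  ≡⟨ ∑⁺-comm n (λ i j → a i * b j) ⟩
  ∑[ i + j ≡ n ] (a j * b i)  ≡⟨ ∑⁺-cong n (λ i j → ℤ.*-comm (a j) (b i)) ⟩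
  ∑[ i + j ≡ n ] (b i * a j)  ≡⟨ ⊛-as-∑⁺ b a n ⟨
  (b ⊛ a) n                   ∎
  where open ≡-Reasoning

⊛-assoc : ∀ a b c → (a ⊛ b) ⊛ c ≈ a ⊛ (b ⊛ c)
⊛-assoc a b c n = begin
  ((a ⊛ b) ⊛ c) n
    ≡⟨ ⊛-as-∑⁺ (a ⊛ b) c n ⟩
  ∑[ m + k ≡ n ] ((a ⊛ b) m * c k)
    ≡⟨ ∑⁺-cong n (λ m k → trans (cong (_* c k) (⊛-as-∑⁺ a b m)) (sym (∑⁺-*ʳ m (c k) (λ i j → a i * b j)))) ⟩
  ∑[ m + k ≡ n ] ∑[ i + j ≡ m ] ((a i * b j) * c k)
    ≡⟨ ∑⁺-assoc n (λ i j k → (a i * b j) * c k) ⟩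
  ∑[ i + m ≡ n ] ∑[ j + k ≡ m ] ((a i * b j) * c k)
    ≡⟨ ∑⁺-cong n (λ i m → trans (∑⁺-cong m (λ j k → ℤ.*-assoc (a i) (b j) (c k)))
                                (∑⁺-*ˡ m (a i) (λ j k → b j * c k))) ⟩
  ∑[ i + m ≡ n ] (a i * ∑[ j + k ≡ m ] (b j * c k))
    ≡⟨ ∑⁺-cong n (λ i m → cong (a i *_) (⊛-as-∑⁺ b c m)) ⟨
  ∑[ i + m ≡ n ] (a i * (b ⊛ c) m)
    ≡⟨ ⊛-as-∑⁺ a (b ⊛ c) n ⟨
  (a ⊛ (b ⊛ c)) n
    ∎
  where open ≡-Reasoning

⊛-distribˡ-⊕ : ∀ a b c → a ⊛ (b ⊕ c) ≈ a ⊛ b ⊕ a ⊛ c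
⊛-distribˡ-⊕ a b c n = begin
  (a ⊛ (b ⊕ c)) n                                          ≡⟨ ⊛-as-∑⁺ a (b ⊕ c) n ⟩
  ∑[ i + j ≡ n ] (a i * (b j + c j))                       ≡⟨ ∑⁺-cong n (λ i j → ℤ.*-distribˡ-+ (a i) (b j) (c j)) ⟩
  ∑[ i + j ≡ n ] (a i * b j + a i * c j)                   ≡⟨ ∑⁺-distrib-+ n (λ i j → a i * b j) (λ i j → a i * c j) ⟩
  ∑[ i + j ≡ n ] (a i * b j) + ∑[ i + j ≡ n ] (a i * c j)  ≡⟨ cong₂ _+_ (⊛-as-∑⁺ a b n) (⊛-as-∑⁺ a c n) ⟨
  (a ⊛ b ⊕ a ⊛ c) n                                        ∎
  where open ≡-Reasoning

cst-⊛ : ∀ c a n → (cst c ⊛ a) n ≡ c * a n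
cst-⊛ c a n = begin
  (cst c ⊛ a) n
    ≡⟨ ⊛-as-∑⁺ (cst c) a n ⟩
  c * a n + ∑[ i < n ] (0ℤ * a (n ∸ suc i))
    ≡⟨ cong (λ t → c * a n + t) (trans (∑<-cong n (λ i _ → ℤ.*-zeroˡ (a (n ∸ suc i)))) (∑<-zero n)) ⟩
  c * a n + 0ℤ
    ≡⟨ ℤ.+-identityʳ (c * a n) ⟩
  c * a n
    ∎
  where open ≡-Reasoning

ℤ[[z]] : CommutativeRing _ _
ℤ[[z]] = record
  { Carrier = Series
  ; _≈_ = _≈_
  ; _+_ = _⊕_
  ; _*_ = _⊛_
  ; -_ = neg
  ; 0# = λ _ → 0ℤ
  ; 1# = cst 1ℤ
  ; isCommutativeRing = record
    { isRing = record
      { +-isAbelianGroup = Pointwise.isAbelianGroup ℕ ℤ.+-0-isAbelianGroup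
      ; *-cong = ⊛-cong
      ; *-assoc = ⊛-assoc
      ; *-identity = ⊛-identityˡ , λ a n → trans (⊛-comm a (cst 1ℤ) n) (⊛-identityˡ a n)
      ; distrib = ⊛-distribˡ-⊕ , ⊛-distribʳ-⊕
      }
    ; *-comm = ⊛-comm
    }
  }
  where
  ⊛-distribʳ-⊕ : ∀ a b c → (b ⊕ c) ⊛ a ≈ b ⊛ a ⊕ c ⊛ a
  ⊛-distribʳ-⊕ a b c n =
    trans (⊛-comm (b ⊕ c) a n) (trans (⊛-distribˡ-⊕ a b c n) (cong₂ _+_ (⊛-comm a b n) (⊛-comm a c n)))
  ⊛-identityˡ : ∀ a → cst 1ℤ ⊛ a ≈ a
  ⊛-identityˡ a n = trans (cst-⊛ 1ℤ a n) (ℤ.*-identityˡ (a n))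

open CommutativeRing ℤ[[z]] using ()
  renaming ( setoid to ℤ[[z]]-setoid; refl to ≈-refl; sym to ≈-sym; trans to ≈-trans; 0# to 𝟘
           ; +-cong to ⊕-cong; +-identityˡ to ⊕-identityˡ; +-identityʳ to ⊕-identityʳ; *-identityˡ to ⊛-identityˡ
           ; zeroʳ to ⊛-zeroʳ
           )

module ≈-Reasoning = Relation.Binary.Reasoning.Setoid ℤ[[z]]-setoid

cst-0 : cst 0ℤ ≈ 𝟘
cst-0 zero    = refl
cst-0 (suc n) = refl

shift : Series → Series
shift a zero    = 0ℤ
shift a (suc n) = a n

z : Series
z = shift (cst 1ℤ)

shift-𝟘 : shift 𝟘 ≈ 𝟘
shift-𝟘 zero    = refl
shift-𝟘 (suc n) = refl

shift-cong : ∀ {a b} → a ≈ b → shift a ≈ shift b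
shift-cong a≈b zero    = refl
shift-cong a≈b (suc n) = a≈b n

shift-as-z⊛ : ∀ a → shift a ≈ z ⊛ a
shift-as-z⊛ a zero    = sym (trans (⊛-as-∑⁺ z a 0) (ℤ.+-identityʳ (0ℤ * a 0)))
shift-as-z⊛ a (suc n) = sym (begin
  (z ⊛ a) (suc n)
    ≡⟨ ⊛-as-∑⁺ z a (suc n) ⟩
  0ℤ * a (suc n) + ∑[ i + j ≡ n ] (cst 1ℤ i * a j)
    ≡⟨ cong₂ _+_ (ℤ.*-zeroˡ (a (suc n))) (sym (⊛-as-∑⁺ (cst 1ℤ) a n)) ⟩
  0ℤ + (cst 1ℤ ⊛ a) n
    ≡⟨ trans (ℤ.+-identityˡ _) (⊛-identityˡ a n) ⟩
  a n
    ∎)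
  where open ≡-Reasoning

horner : List ℤ → Series → Series
horner []       x = cst 0ℤ
horner (c ∷ cs) x = cst c ⊕ x ⊛ horner cs x

poly-as-horner : ∀ cs → poly cs ≈ horner cs z
poly-as-horner []       n = sym (cst-0 n)
poly-as-horner (c ∷ cs) n = begin
  poly (c ∷ cs) n                ≡⟨ poly-∷ n ⟩
  cst c n + shift (poly cs) n    ≡⟨ cong (λ t → cst c n + t) (shift-as-z⊛ (poly cs) n) ⟩
  cst c n + (z ⊛ poly cs) n      ≡⟨ cong (λ t → cst c n + t) (⊛-cong (≈-refl {z}) (poly-as-horner cs) n) ⟩
  cst c n + (z ⊛ horner cs z) n  ∎
  where
  open ≡-Reasoning
  poly-∷ : ∀ n → poly (c ∷ cs) n ≡ cst c n + shift (poly cs) n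
  poly-∷ zero    = sym (ℤ.+-identityʳ c)
  poly-∷ (suc n) = sym (ℤ.+-identityˡ (poly cs n))

horner-cong : ∀ cs {x y} → x ≈ y → horner cs x ≈ horner cs y
horner-cong []       x≈y n = refl
horner-cong (c ∷ cs) x≈y n = cong (λ t → cst c n + t) (⊛-cong x≈y (horner-cong cs x≈y) n)

⊛-leading : ∀ n a b → (∀ k → k ℕ.< n → a k ≡ 0ℤ) → (a ⊛ b) n ≡ a n * b 0
⊛-leading n a b a<n≡0 = begin
  (a ⊛ b) n                         ≡⟨ ⊛-as-∑⁺ a b n ⟩
  ∑[ i < suc n ] (a i * b (n ∸ i))  ≡⟨ ∑<-only-last n (λ i → a i * b (n ∸ i)) earlier-vanish ⟩
  a n * b (n ∸ n)                   ≡⟨ cong (λ k → a n * b k) (ℕ.n∸n≡0 n) ⟩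
  a n * b 0                         ∎
  where
  open ≡-Reasoning
  earlier-vanish : ∀ i → i ℕ.< n → a i * b (n ∸ i) ≡ 0ℤ
  earlier-vanish i i<n = trans (cong (_* b (n ∸ i)) (a<n≡0 i i<n)) (ℤ.*-zeroˡ (b (n ∸ i)))

a⊛b≈𝟘⇒a≈𝟘 : ∀ a b → b 0 ≢ 0ℤ → a ⊛ b ≈ 𝟘 → a ≈ 𝟘
a⊛b≈𝟘⇒a≈𝟘 a b b₀≢0 ab≈0 = <-rec (λ n → a n ≡ 0ℤ) step
  where
  step : ∀ n → (∀ {k} → k ℕ.< n → a k ≡ 0ℤ) → a n ≡ 0ℤ
  step n a<n≡0 with ℤ.i*j≡0⇒i≡0∨j≡0 (a n) (trans (sym (⊛-leading n a b (λ k → a<n≡0))) (ab≈0 n))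
  ... | inj₁ aₙ≡0 = aₙ≡0
  ... | inj₂ b₀≡0 = contradiction b₀≡0 b₀≢0

cst-homomorphism : ℤ.+-*-rawRing -Raw-AlmostCommutative⟶ fromCommutativeRing ℤ[[z]]
cst-homomorphism = record
  { ⟦_⟧ = cst
  ; +-homo = λ { a b zero → refl ; a b (suc n) → refl }
  ; *-homo = λ a b n → trans (cst-* a b n) (sym (cst-⊛ a (cst b) n))
  ; -‿homo = λ { a zero → refl ; a (suc n) → refl }
  ; 0-homo = λ { zero → refl ; (suc n) → refl }
  ; 1-homo = λ n → refl
  }
  where
  cst-* : ∀ a b n → cst (a * b) n ≡ a * cst b n
  cst-* a b zero    = refl
  cst-* a b (suc n) = sym (ℤ.*-zeroʳ a)

cst-≟ : ∀ a b → Maybe (cst a ≈ cst b)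
cst-≟ a b with a ℤ.≟ b
... | yes refl = just (λ n → refl)
... | no _     = nothing

module ℤ[[z]]-Solver = RingSolver ℤ.+-*-rawRing (fromCommutativeRing ℤ[[z]]) cst-homomorphism cst-≟
open ℤ[[z]]-Solver using (solve; _:=_; _:+_; _:*_; _:-_; con)

infixl 6 _⊝_
_⊝_ : Series → Series → Series
a ⊝ b = a ⊕ neg b

hornerₚ : ∀ {n} → List ℤ → ℤ[[z]]-Solver.Polynomial n → ℤ[[z]]-Solver.Polynomial n
hornerₚ []       x = con 0ℤ
hornerₚ (c ∷ cs) x = con c :+ x :* hornerₚ cs x

-- A consequence a ≈ b of hypotheses xᵢ ≈ yᵢ is certified by letting the solver check a ⊝ b ≈ Σ lᵢ ⊛ (xᵢ ⊝ yᵢ).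
≈-from-⊝ : ∀ {a b c} → a ⊝ b ≈ c → c ≈ 𝟘 → a ≈ b
≈-from-⊝ {a} {b} a-b≈c c≈0 n = ℤ.i-j≡0⇒i≡j (a n) (b n) (trans (a-b≈c n) (c≈0 n))

⊕-vanishing : ∀ {l x y r} → x ≈ y → r ≈ 𝟘 → l ⊛ (x ⊝ y) ⊕ r ≈ 𝟘
⊕-vanishing {l} {x} {y} {r} x≈y r≈0 n = begin
  (l ⊛ (x ⊝ y)) n + r n  ≡⟨ cong₂ _+_ (⊛-cong (≈-refl {l}) x-y≈0 n) (r≈0 n) ⟩
  (l ⊛ 𝟘) n + 0ℤ         ≡⟨ ℤ.+-identityʳ _ ⟩
  (l ⊛ 𝟘) n              ≡⟨ ⊛-zeroʳ l n ⟩
  0ℤ                     ∎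
  where
  open ≡-Reasoning
  x-y≈0 : x ⊝ y ≈ 𝟘
  x-y≈0 n = ℤ.i≡j⇒i-j≡0 (x≈y n)

square-root-unique : ∀ s t → s 0 ≡ 1ℤ → t 0 ≡ 1ℤ → s ⊛ s ≈ t ⊛ t → s ≈ t
square-root-unique s t s₀≡1 t₀≡1 s²≈t² =
  ≈-from-⊝ (≈-refl {s ⊝ t}) (a⊛b≈𝟘⇒a≈𝟘 (s ⊝ t) (s ⊕ t) [s+t]₀≢0 [s-t][s+t]≈0)
  where
  [s+t]₀≢0 : s 0 + t 0 ≢ 0ℤ
  [s+t]₀≢0 rewrite s₀≡1 | t₀≡1 = λ ()
  [s-t][s+t]≈0 : (s ⊝ t) ⊛ (s ⊕ t) ≈ 𝟘
  [s-t][s+t]≈0 = ≈-trans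
    (solve 2 (λ s t → (s :- t) :* (s :+ t) := con 1ℤ :* (s :* s :- t :* t) :+ con 0ℤ) (λ _ → refl) s t)
    (⊕-vanishing {l = cst 1ℤ} s²≈t² cst-0)

when : Bool → ℤ → ℤ
when b x = if b then x else 0ℤ

when-+ : ∀ b x y → when b (x + y) ≡ when b x + when b y
when-+ true  x y = refl
when-+ false x y = refl

when-*ˡ : ∀ b c x → when b (c * x) ≡ c * when b x
when-*ˡ true  c x = refl
when-*ˡ false c x = sym (ℤ.*-zeroʳ c)

when-∑< : ∀ b m (F : ℕ → ℤ) → when b (∑< m F) ≡ ∑[ i < m ] when b (F i)
when-∑< true  m F = refl
when-∑< false m F = sym (∑<-zero m)

∑-word : ℕ → (List Step → ℤ) → ℤ
∑-word zero    f = f []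
∑-word (suc L) f = ∑-word L (λ w → f (U ∷ w)) + ∑-word L (λ w → f (D ∷ w))

infixl 10 ∑-word
syntax ∑-word L (λ w → e) = ∑[ w ∈Word L ] e

sumℤ-words : ∀ L f → sumℤ (map f (words L)) ≡ ∑-word L f
sumℤ-words zero    f = ℤ.+-identityʳ (f [])
sumℤ-words (suc L) f = begin
  sumℤ (map f (words (suc L)))                       ≡⟨ sumℤ-concatMap (words L) ⟩
  sumℤ (map (λ w → fU w + fD w) (words L))           ≡⟨ sumℤ-map-+ (words L) ⟩
  sumℤ (map fU (words L)) + sumℤ (map fD (words L))  ≡⟨ cong₂ _+_ (sumℤ-words L fU) (sumℤ-words L fD) ⟩
  ∑-word (suc L) f                                   ∎
  where
  open ≡-Reasoning
  fU fD : List Step → ℤ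
  fU w = f (U ∷ w)
  fD w = f (D ∷ w)
  sumℤ-concatMap : ∀ ws →
    sumℤ (map f (concatMap (λ w → (U ∷ w) ∷ (D ∷ w) ∷ []) ws)) ≡ sumℤ (map (λ w → fU w + fD w) ws)
  sumℤ-concatMap []       = refl
  sumℤ-concatMap (w ∷ ws) = trans (cong (λ t → fU w + (fD w + t)) (sumℤ-concatMap ws)) (sym (ℤ.+-assoc (fU w) (fD w) _))
  sumℤ-map-+ : ∀ ws → sumℤ (map (λ w → fU w + fD w) ws) ≡ sumℤ (map fU ws) + sumℤ (map fD ws)
  sumℤ-map-+ []       = refl
  sumℤ-map-+ (w ∷ ws) = trans (cong (λ t → (fU w + fD w) + t) (sumℤ-map-+ ws)) (interchange (fU w) (fD w) _ _)

∑-word-cong : ∀ L {f g : List Step → ℤ} → (∀ w → f w ≡ g w) → ∑-word L f ≡ ∑-word L g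
∑-word-cong zero    f≡g = f≡g []
∑-word-cong (suc L) f≡g = cong₂ _+_ (∑-word-cong L (λ w → f≡g (U ∷ w))) (∑-word-cong L (λ w → f≡g (D ∷ w)))

∑-word-zero : ∀ L → ∑[ w ∈Word L ] 0ℤ ≡ 0ℤ
∑-word-zero zero    = refl
∑-word-zero (suc L) = cong₂ _+_ (∑-word-zero L) (∑-word-zero L)

∑-word-distrib-+ : ∀ L (f g : List Step → ℤ) → ∑[ w ∈Word L ] (f w + g w) ≡ ∑-word L f + ∑-word L g
∑-word-distrib-+ zero    f g = refl
∑-word-distrib-+ (suc L) f g
  rewrite ∑-word-distrib-+ L (λ w → f (U ∷ w)) (λ w → g (U ∷ w))
        | ∑-word-distrib-+ L (λ w → f (D ∷ w)) (λ w → g (D ∷ w))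
  = interchange (∑-word L (λ w → f (U ∷ w))) (∑-word L (λ w → g (U ∷ w)))
                (∑-word L (λ w → f (D ∷ w))) (∑-word L (λ w → g (D ∷ w)))

∑-word-*ˡ : ∀ L c (f : List Step → ℤ) → ∑[ w ∈Word L ] (c * f w) ≡ c * ∑-word L f
∑-word-*ˡ zero    c f = refl
∑-word-*ˡ (suc L) c f
  rewrite ∑-word-*ˡ L c (λ w → f (U ∷ w)) | ∑-word-*ˡ L c (λ w → f (D ∷ w)) = sym (ℤ.*-distribˡ-+ c _ _)

∑-word-∑< : ∀ L m (F : ℕ → List Step → ℤ) → ∑[ w ∈Word L ] ∑[ i < m ] F i w ≡ ∑[ i < m ] ∑-word L (F i)
∑-word-∑< L zero    F = ∑-word-zero L
∑-word-∑< L (suc m) F = trans (∑-word-distrib-+ L (F 0) (λ w → ∑[ i < m ] F (suc i) w))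
                              (cong (λ t → ∑-word L (F 0) + t) (∑-word-∑< L m (F ∘ suc)))

-- w = x D y, where this D is the first step of w down to height h.
∑-word-firstPassage : ∀ L k h (g : List Step → ℤ) →
  ∑[ w ∈Word L ] when (isDyckFrom (k ℕ.+ suc h) w) (g w) ≡
  ∑[ a < L ] ∑[ x ∈Word a ] when (isDyckFrom k x) (∑[ y ∈Word (L ∸ suc a) ] when (isDyckFrom h y) (g (x ++ D ∷ y)))
∑-word-firstPassage zero k h g rewrite ℕ.+-suc k h = refl
∑-word-firstPassage (suc L) zero h g = begin
  up + down          ≡⟨ cong (_+ down) (∑-word-firstPassage L 1 h (λ w → g (U ∷ w))) ⟩
  ∑< L viaUp + down  ≡⟨ ℤ.+-comm (∑< L viaUp) down ⟩
  down + ∑< L viaUp  ≡⟨ cong (λ t → down + t) (∑<-cong L (λ a _ → sym (padded a))) ⟩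
  down + ∑[ a < L ] (viaUp a + ∑[ x ∈Word a ] 0ℤ)  ∎
  where
  open ≡-Reasoning
  up down : ℤ
  up   = ∑[ w ∈Word L ] when (isDyckFrom (suc (suc h)) w) (g (U ∷ w))
  down = ∑[ w ∈Word L ] when (isDyckFrom h w) (g (D ∷ w))
  viaUp : ℕ → ℤ
  viaUp a = ∑[ x ∈Word a ] when (isDyckFrom 1 x) (∑[ y ∈Word (L ∸ suc a) ] when (isDyckFrom h y) (g (U ∷ x ++ D ∷ y)))
  padded : ∀ a → viaUp a + ∑[ x ∈Word a ] 0ℤ ≡ viaUp a
  padded a = trans (cong (λ t → viaUp a + t) (∑-word-zero a)) (ℤ.+-identityʳ (viaUp a))
∑-word-firstPassage (suc L) (suc k) h g = begin
  up + down
    ≡⟨ cong₂ _+_ (∑-word-firstPassage L (suc (suc k)) h (λ w → g (U ∷ w))) (∑-word-firstPassage L k h (λ w → g (D ∷ w))) ⟩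
  ∑< L (via U (suc (suc k))) + ∑< L (via D k)
    ≡⟨ ∑<-distrib-+ L (via U (suc (suc k))) (via D k) ⟨
  ∑[ a < L ] ∑[ x ∈Word suc a ] when (isDyckFrom (suc k) x) (rest a x)
    ≡⟨ ℤ.+-identityˡ _ ⟨
  0ℤ + ∑[ a < L ] ∑[ x ∈Word suc a ] when (isDyckFrom (suc k) x) (rest a x)
    ∎
  where
  open ≡-Reasoning
  up down : ℤ
  up   = ∑[ w ∈Word L ] when (isDyckFrom (suc (suc k) ℕ.+ suc h) w) (g (U ∷ w))
  down = ∑[ w ∈Word L ] when (isDyckFrom (k ℕ.+ suc h) w) (g (D ∷ w))
  rest : ℕ → List Step → ℤ
  rest a x = ∑[ y ∈Word (L ∸ suc a) ] when (isDyckFrom h y) (g (x ++ D ∷ y))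
  via : Step → ℕ → ℕ → ℤ
  via s k′ a = ∑[ x ∈Word a ] when (isDyckFrom k′ x) (rest a (s ∷ x))

isEven : ℕ → Bool
isEven zero    = true
isEven (suc n) = not (isEven n)

isEven-double : ∀ j → isEven (j ℕ.+ j) ≡ true
isEven-double zero    = refl
isEven-double (suc j) rewrite ℕ.+-suc j j | isEven-double j = refl

∑-word-isDyckFrom-odd : ∀ L k (f : List Step → ℤ) → isEven (L ℕ.+ k) ≡ false →
  ∑[ x ∈Word L ] when (isDyckFrom k x) (f x) ≡ 0ℤ
∑-word-isDyckFrom-odd zero    zero    f ()
∑-word-isDyckFrom-odd zero    (suc k) f odd = refl
∑-word-isDyckFrom-odd (suc L) zero    f odd =
  cong₂ _+_ (∑-word-isDyckFrom-odd L 1 (λ x → f (U ∷ x)) (trans (cong isEven (ℕ.+-suc L 0)) odd)) (∑-word-zero L)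
∑-word-isDyckFrom-odd (suc L) (suc k) f odd =
  cong₂ _+_ (∑-word-isDyckFrom-odd L (suc (suc k)) (λ x → f (U ∷ x)) up-odd)
            (∑-word-isDyckFrom-odd L k (λ x → f (D ∷ x)) down-odd)
  where
  up-odd : isEven (L ℕ.+ suc (suc k)) ≡ false
  up-odd = trans (cong isEven (ℕ.+-suc L (suc k))) odd
  down-odd : isEven (L ℕ.+ k) ≡ false
  down-odd = trans (sym (not-involutive (isEven (L ℕ.+ k)))) (trans (cong (not ∘ isEven) (sym (ℕ.+-suc L k))) odd)

∑<-evens : ∀ n (G : ℕ → ℤ) → (∀ j → G (suc (j ℕ.+ j)) ≡ 0ℤ) → ∑< (suc (n ℕ.+ n)) G ≡ ∑[ i < suc n ] G (i ℕ.+ i)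
∑<-evens zero    G odd≡0 = refl
∑<-evens (suc m) G odd≡0 rewrite ℕ.+-suc m m = cong (λ t → G 0 + t) (begin
  G 1 + ∑< (suc (m ℕ.+ m)) (G ∘ suc ∘ suc)  ≡⟨ cong (_+ ∑< (suc (m ℕ.+ m)) (G ∘ suc ∘ suc)) (odd≡0 0) ⟩
  0ℤ + ∑< (suc (m ℕ.+ m)) (G ∘ suc ∘ suc)   ≡⟨ ℤ.+-identityˡ _ ⟩
  ∑< (suc (m ℕ.+ m)) (G ∘ suc ∘ suc)        ≡⟨ ∑<-evens m (G ∘ suc ∘ suc) odd≡0′ ⟩
  ∑[ i < suc m ] G (suc (suc (i ℕ.+ i)))    ≡⟨ ∑<-cong (suc m) (λ i _ → cong G (sym (cong suc (ℕ.+-suc i i)))) ⟩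
  ∑[ i < suc m ] G (suc i ℕ.+ suc i)        ∎)
  where
  open ≡-Reasoning
  odd≡0′ : ∀ j → G (suc (suc (suc (j ℕ.+ j)))) ≡ 0ℤ
  odd≡0′ j = trans (cong G (cong suc (sym (ℕ.+-suc (suc j) j)))) (odd≡0 (suc j))

-- Sums over Dyck paths

∑-Dyck : ℕ → (List Step → ℤ) → ℤ
∑-Dyck n f = ∑[ w ∈Word (n ℕ.+ n) ] when (isDyck w) (f w)

infixl 10 ∑-Dyck
syntax ∑-Dyck n (λ p → e) = ∑[ p ∈Dyck n ] e

∑-Dyck-firstReturn : ∀ n (f : List Step → ℤ) →
  ∑-Dyck (suc n) f ≡ ∑[ i + j ≡ n ] ∑[ x ∈Dyck i ] ∑[ y ∈Dyck j ] f (U ∷ x ++ D ∷ y)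
∑-Dyck-firstReturn n f rewrite ℕ.+-suc n n = begin
  ∑[ w ∈Word L ] when (isDyckFrom 1 w) (f (U ∷ w)) + ∑[ w ∈Word L ] 0ℤ
    ≡⟨ cong (λ t → ∑[ w ∈Word L ] when (isDyckFrom 1 w) (f (U ∷ w)) + t) (∑-word-zero L) ⟩
  ∑[ w ∈Word L ] when (isDyckFrom 1 w) (f (U ∷ w)) + 0ℤ
    ≡⟨ ℤ.+-identityʳ _ ⟩
  ∑[ w ∈Word L ] when (isDyckFrom 1 w) (f (U ∷ w))
    ≡⟨ ∑-word-firstPassage L 0 0 (λ w → f (U ∷ w)) ⟩
  ∑< L passage
    ≡⟨ ∑<-evens n passage odd-vanishes ⟩
  ∑[ i < suc n ] passage (i ℕ.+ i)
    ≡⟨ ∑<-cong (suc n) (λ i i<1+n → cong (tailsOfLength i) (double-∸ n i (ℕ.≤-pred i<1+n))) ⟩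
  ∑[ i + j ≡ n ] ∑[ x ∈Dyck i ] ∑[ y ∈Dyck j ] f (U ∷ x ++ D ∷ y)
    ∎
  where
  open ≡-Reasoning
  L : ℕ
  L = suc (n ℕ.+ n)
  passage : ℕ → ℤ
  passage a = ∑[ x ∈Word a ] when (isDyck x) (∑[ y ∈Word (L ∸ suc a) ] when (isDyck y) (f (U ∷ x ++ D ∷ y)))
  tailsOfLength : ℕ → ℕ → ℤ
  tailsOfLength i m = ∑[ x ∈Dyck i ] ∑[ y ∈Word m ] when (isDyck y) (f (U ∷ x ++ D ∷ y))
  odd-vanishes : ∀ j → passage (suc (j ℕ.+ j)) ≡ 0ℤ
  odd-vanishes j = ∑-word-isDyckFrom-odd (suc (j ℕ.+ j)) 0
    (λ x → ∑[ y ∈Word (L ∸ suc (suc (j ℕ.+ j))) ] when (isDyck y) (f (U ∷ x ++ D ∷ y)))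
    (trans (cong isEven (ℕ.+-identityʳ (suc (j ℕ.+ j)))) (cong not (isEven-double j)))
  double-∸ : ∀ n i → i ℕ.≤ n → (n ℕ.+ n) ∸ (i ℕ.+ i) ≡ (n ∸ i) ℕ.+ (n ∸ i)
  double-∸ n       zero    _         = refl
  double-∸ (suc n) (suc i) (s≤s i≤n) rewrite ℕ.+-suc n n | ℕ.+-suc i i = double-∸ n i i≤n

∑-Dyck-cong : ∀ n {f g : List Step → ℤ} → (∀ p → isDyck p ≡ true → f p ≡ g p) → ∑-Dyck n f ≡ ∑-Dyck n g
∑-Dyck-cong n {f} {g} f≡g = ∑-word-cong (n ℕ.+ n) on-Dyck
  where
  on-Dyck : ∀ w → when (isDyck w) (f w) ≡ when (isDyck w) (g w)
  on-Dyck w with isDyck w in dyck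
  ... | true  = f≡g w dyck
  ... | false = refl

∑-Dyck-zero : ∀ n → ∑[ p ∈Dyck n ] 0ℤ ≡ 0ℤ
∑-Dyck-zero n = trans (∑-word-cong (n ℕ.+ n) (λ w → when-0 (isDyck w))) (∑-word-zero (n ℕ.+ n))
  where
  when-0 : ∀ b → when b 0ℤ ≡ 0ℤ
  when-0 true  = refl
  when-0 false = refl

∑-Dyck-distrib-+ : ∀ n (f g : List Step → ℤ) → ∑[ p ∈Dyck n ] (f p + g p) ≡ ∑-Dyck n f + ∑-Dyck n g
∑-Dyck-distrib-+ n f g = trans (∑-word-cong (n ℕ.+ n) (λ w → when-+ (isDyck w) (f w) (g w))) (∑-word-distrib-+ (n ℕ.+ n) _ _)

∑-Dyck-*ˡ : ∀ n c (f : List Step → ℤ) → ∑[ p ∈Dyck n ] (c * f p) ≡ c * ∑-Dyck n f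
∑-Dyck-*ˡ n c f = trans (∑-word-cong (n ℕ.+ n) (λ w → when-*ˡ (isDyck w) c (f w))) (∑-word-*ˡ (n ℕ.+ n) c _)

∑-Dyck-*ʳ : ∀ n c (f : List Step → ℤ) → ∑[ p ∈Dyck n ] (f p * c) ≡ ∑-Dyck n f * c
∑-Dyck-*ʳ n c f = trans (∑-Dyck-cong n (λ p _ → ℤ.*-comm (f p) c)) (trans (∑-Dyck-*ˡ n c f) (ℤ.*-comm c _))

∑-Dyck-∑< : ∀ n m (F : ℕ → List Step → ℤ) → ∑[ p ∈Dyck n ] ∑[ i < m ] F i p ≡ ∑[ i < m ] ∑-Dyck n (F i)
∑-Dyck-∑< n m F = trans (∑-word-cong (n ℕ.+ n) (λ w → when-∑< (isDyck w) m (λ i → F i w))) (∑-word-∑< (n ℕ.+ n) m _)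

∑-Dyck-∑⁺ : ∀ n m (F : ℕ → ℕ → List Step → ℤ) →
  ∑[ p ∈Dyck n ] ∑[ a + b ≡ m ] F a b p ≡ ∑[ a + b ≡ m ] ∑-Dyck n (F a b)
∑-Dyck-∑⁺ n m F = ∑-Dyck-∑< n (suc m) (λ a → F a (m ∸ a))

-- The tail y of the first return U x D y is split at its last return, and U x D y₁ regrouped as the prefix.
∑-Dyck-lastReturn : ∀ n (f : List Step → ℤ) →
  ∑-Dyck (suc n) f ≡ ∑[ i + j ≡ n ] ∑[ x ∈Dyck i ] ∑[ y ∈Dyck j ] f (x ++ U ∷ y ++ D ∷ [])
∑-Dyck-lastReturn = <-rec LastReturn step
  where
  LastReturn : ℕ → Set
  LastReturn n = ∀ f → ∑-Dyck (suc n) f ≡ ∑[ i + j ≡ n ] ∑[ x ∈Dyck i ] ∑[ y ∈Dyck j ] f (x ++ U ∷ y ++ D ∷ [])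
  step : ∀ n → (∀ {b} → b ℕ.< n → LastReturn b) → LastReturn n
  step zero    _  f = ∑-Dyck-firstReturn 0 f
  step (suc m) ih f = begin
    ∑-Dyck (suc (suc m)) f
      ≡⟨ ∑-Dyck-firstReturn (suc m) f ⟩
    ∑[ a + b ≡ suc m ] ∑[ x ∈Dyck a ] ∑[ y ∈Dyck b ] f (U ∷ x ++ D ∷ y)
      ≡⟨ ∑⁺-suc-last m (λ a b → ∑[ x ∈Dyck a ] ∑[ y ∈Dyck b ] f (U ∷ x ++ D ∷ y)) ⟩
    ∑[ a + b ≡ m ] ∑[ x ∈Dyck a ] ∑[ y ∈Dyck suc b ] f (U ∷ x ++ D ∷ y) + emptyTail
      ≡⟨ cong (_+ emptyTail) nonemptyTail ⟩
    ∑[ e + d ≡ m ] ∑[ x ∈Dyck suc e ] ∑[ y ∈Dyck d ] f (x ++ U ∷ y ++ D ∷ []) + emptyTail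
      ≡⟨ ℤ.+-comm (∑[ e + d ≡ m ] ∑[ x ∈Dyck suc e ] ∑[ y ∈Dyck d ] f (x ++ U ∷ y ++ D ∷ [])) emptyTail ⟩
    emptyTail + ∑[ e + d ≡ m ] ∑[ x ∈Dyck suc e ] ∑[ y ∈Dyck d ] f (x ++ U ∷ y ++ D ∷ [])
      ∎
    where
    open ≡-Reasoning
    emptyTail : ℤ
    emptyTail = ∑[ x ∈Dyck suc m ] f (U ∷ x ++ D ∷ [])
    g : List Step → List Step → List Step → ℤ
    g x y y′ = f (U ∷ x ++ D ∷ y ++ U ∷ y′ ++ D ∷ [])
    regroup : ∀ x y y′ → g x y y′ ≡ f ((U ∷ x ++ D ∷ y) ++ U ∷ y′ ++ D ∷ [])
    regroup x y y′ = cong (λ p → f (U ∷ p)) (sym (++-assoc x (D ∷ y) (U ∷ y′ ++ D ∷ [])))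
    nonemptyTail : ∑[ a + b ≡ m ] ∑[ x ∈Dyck a ] ∑[ y ∈Dyck suc b ] f (U ∷ x ++ D ∷ y)
                 ≡ ∑[ e + d ≡ m ] ∑[ x ∈Dyck suc e ] ∑[ y ∈Dyck d ] f (x ++ U ∷ y ++ D ∷ [])
    nonemptyTail = begin
      ∑[ a + b ≡ m ] ∑[ x ∈Dyck a ] ∑[ y ∈Dyck suc b ] f (U ∷ x ++ D ∷ y)
        ≡⟨ ∑⁺-cong-≤ m (λ a b b≤m → ∑-Dyck-cong a (λ x _ → ih (s≤s b≤m) (λ y → f (U ∷ x ++ D ∷ y)))) ⟩
      ∑[ a + b ≡ m ] ∑[ x ∈Dyck a ] ∑[ c + d ≡ b ] ∑[ y ∈Dyck c ] ∑[ y′ ∈Dyck d ] g x y y′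
        ≡⟨ ∑⁺-cong m (λ a b → ∑-Dyck-∑⁺ a b (λ c d x → ∑[ y ∈Dyck c ] ∑[ y′ ∈Dyck d ] g x y y′)) ⟩
      ∑[ a + b ≡ m ] ∑[ c + d ≡ b ] ∑[ x ∈Dyck a ] ∑[ y ∈Dyck c ] ∑[ y′ ∈Dyck d ] g x y y′
        ≡⟨ ∑⁺-assoc m (λ a c d → ∑[ x ∈Dyck a ] ∑[ y ∈Dyck c ] ∑[ y′ ∈Dyck d ] g x y y′) ⟨
      ∑[ e + d ≡ m ] ∑[ a + c ≡ e ] ∑[ x ∈Dyck a ] ∑[ y ∈Dyck c ] ∑[ y′ ∈Dyck d ] g x y y′
        ≡⟨ ∑⁺-cong m (λ e d → trans
             (∑⁺-cong e (λ a c → ∑-Dyck-cong a (λ x _ → ∑-Dyck-cong c (λ y _ →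
                                  ∑-Dyck-cong d (λ y′ _ → regroup x y y′)))))
             (sym (∑-Dyck-firstReturn e (λ x → ∑[ y′ ∈Dyck d ] f (x ++ U ∷ y′ ++ D ∷ []))))) ⟩
      ∑[ e + d ≡ m ] ∑[ x ∈Dyck suc e ] ∑[ y ∈Dyck d ] f (x ++ U ∷ y ++ D ∷ [])
        ∎

-- Symmetric valleys

leadingUps : List Step → ℕ
leadingUps (U ∷ w) = suc (leadingUps w)
leadingUps _       = 0

trailingDownsFrom : ℕ → List Step → ℕ
trailingDownsFrom k []      = k
trailingDownsFrom k (D ∷ w) = trailingDownsFrom (suc k) w
trailingDownsFrom k (U ∷ w) = trailingDownsFrom 0 w

trailingDowns : List Step → ℕ
trailingDowns = trailingDownsFrom 0

valleyWeight : ℕ → ℕ → ℕ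
valleyWeight i j = if i ≡ᵇ j then i else 0

-- svwAfterDowns k w is the symmetric valley weight of the word D^k w.
svwAfterDowns : ℕ → List Step → ℕ
svwAfterDowns k []      = 0
svwAfterDowns k (D ∷ w) = svwAfterDowns (suc k) w
svwAfterDowns k (U ∷ w) = valleyWeight k (suc (leadingUps w)) ℕ.+ svwAfterDowns 0 w

pushRun : Step → List (Step × ℕ) → List (Step × ℕ)
pushRun s []             = (s , 1) ∷ []
pushRun s ((t , k) ∷ rs) = if sameStep s t then (t , suc k) ∷ rs else (s , 1) ∷ (t , k) ∷ rs

rle-∷ : ∀ s w → rle (s ∷ w) ≡ pushRun s (rle w)
rle-∷ s w with rle w
... | []           = refl
... | (t , k) ∷ rs = refl

prependDowns : ℕ → List (Step × ℕ) → List (Step × ℕ)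
prependDowns zero    rs             = rs
prependDowns (suc k) []             = (D , suc k) ∷ []
prependDowns (suc k) ((D , i) ∷ rs) = (D , i ℕ.+ suc k) ∷ rs
prependDowns (suc k) ((U , j) ∷ rs) = (D , suc k) ∷ (U , j) ∷ rs

prependDowns-pushRun : ∀ k rs → prependDowns k (pushRun D rs) ≡ prependDowns (suc k) rs
prependDowns-pushRun zero    []             = refl
prependDowns-pushRun (suc k) []             = refl
prependDowns-pushRun zero    ((D , i) ∷ rs) = cong (λ m → (D , m) ∷ rs) (ℕ.+-comm 1 i)
prependDowns-pushRun (suc k) ((D , i) ∷ rs) = cong (λ m → (D , m) ∷ rs) (sym (ℕ.+-suc i (suc k)))
prependDowns-pushRun zero    ((U , j) ∷ rs) = refl
prependDowns-pushRun (suc k) ((U , j) ∷ rs) = refl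

dropUpRun : List (Step × ℕ) → List (Step × ℕ)
dropUpRun ((U , j) ∷ rs) = rs
dropUpRun rs             = rs

pushRun-U : ∀ w → pushRun U (rle w) ≡ (U , suc (leadingUps w)) ∷ dropUpRun (rle w)
pushRun-U []      = refl
pushRun-U (U ∷ w) rewrite rle-∷ U w | pushRun-U w = refl
pushRun-U (D ∷ w) rewrite rle-∷ D w with rle w
... | []           = refl
... | (U , j) ∷ rs = refl
... | (D , i) ∷ rs = refl

svwRuns-dropUpRun : ∀ rs → svwRuns (dropUpRun rs) ≡ svwRuns rs
svwRuns-dropUpRun []             = refl
svwRuns-dropUpRun ((U , j) ∷ rs) = refl
svwRuns-dropUpRun ((D , i) ∷ rs) = refl

valleyWeight-zero : ∀ j → valleyWeight 0 j ≡ 0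
valleyWeight-zero zero    = refl
valleyWeight-zero (suc j) = refl

svwAfterDowns-as-svwRuns : ∀ k w → svwAfterDowns k w ≡ svwRuns (prependDowns k (rle w))
svwAfterDowns-as-svwRuns zero    [] = refl
svwAfterDowns-as-svwRuns (suc k) [] = refl
svwAfterDowns-as-svwRuns k (D ∷ w)
  rewrite rle-∷ D w | prependDowns-pushRun k (rle w) = svwAfterDowns-as-svwRuns (suc k) w
svwAfterDowns-as-svwRuns zero (U ∷ w)
  rewrite rle-∷ U w | pushRun-U w | valleyWeight-zero (suc (leadingUps w))
  = trans (svwAfterDowns-as-svwRuns 0 w) (sym (svwRuns-dropUpRun (rle w)))
svwAfterDowns-as-svwRuns (suc k) (U ∷ w)
  rewrite rle-∷ U w | pushRun-U w
  = cong (valleyWeight (suc k) (suc (leadingUps w)) ℕ.+_)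
         (trans (svwAfterDowns-as-svwRuns 0 w) (sym (svwRuns-dropUpRun (rle w))))

leadingUps-++ : ∀ x y → leadingUps (x ++ D ∷ y) ≡ leadingUps x
leadingUps-++ []      y = refl
leadingUps-++ (U ∷ x) y = cong suc (leadingUps-++ x y)
leadingUps-++ (D ∷ x) y = refl

trailingDownsFrom-++ : ∀ k x y → trailingDownsFrom k (x ++ D ∷ y) ≡ trailingDownsFrom (suc (trailingDownsFrom k x)) y
trailingDownsFrom-++ k []      y = refl
trailingDownsFrom-++ k (D ∷ x) y = trailingDownsFrom-++ (suc k) x y
trailingDownsFrom-++ k (U ∷ x) y = trailingDownsFrom-++ 0 x y

svwAfterDowns-++ : ∀ k x y → svwAfterDowns k (x ++ D ∷ y) ≡ svwAfterDowns k x ℕ.+ svwAfterDowns (suc (trailingDownsFrom k x)) y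
svwAfterDowns-++ k []      y = refl
svwAfterDowns-++ k (D ∷ x) y = svwAfterDowns-++ (suc k) x y
svwAfterDowns-++ k (U ∷ x) y rewrite leadingUps-++ x y | svwAfterDowns-++ 0 x y =
  sym (ℕ.+-assoc (valleyWeight k (suc (leadingUps x))) _ _)

svwAfterDowns-Dyck : ∀ k y → isDyck y ≡ true → svwAfterDowns k y ≡ svwAfterDowns 0 y ℕ.+ valleyWeight k (leadingUps y)
svwAfterDowns-Dyck zero    []      _ = refl
svwAfterDowns-Dyck (suc k) []      _ = refl
svwAfterDowns-Dyck k       (U ∷ y) _ rewrite valleyWeight-zero (suc (leadingUps y)) =
  ℕ.+-comm (valleyWeight k (suc (leadingUps y))) _

svw-as-svwAfterDowns : ∀ w → svw w ≡ svwAfterDowns 0 w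
svw-as-svwAfterDowns w = sym (svwAfterDowns-as-svwRuns 0 w)

svw-firstReturn : ∀ x y → isDyck y ≡ true →
  svw (U ∷ x ++ D ∷ y) ≡ svw x ℕ.+ svw y ℕ.+ valleyWeight (suc (trailingDowns x)) (leadingUps y)
svw-firstReturn x y dyck = begin
  svw (U ∷ x ++ D ∷ y)
    ≡⟨ svw-as-svwAfterDowns (U ∷ x ++ D ∷ y) ⟩
  valleyWeight 0 (suc (leadingUps (x ++ D ∷ y))) ℕ.+ svwAfterDowns 0 (x ++ D ∷ y)
    ≡⟨ cong (ℕ._+ svwAfterDowns 0 (x ++ D ∷ y)) (valleyWeight-zero (suc (leadingUps (x ++ D ∷ y)))) ⟩
  svwAfterDowns 0 (x ++ D ∷ y)
    ≡⟨ svwAfterDowns-++ 0 x y ⟩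
  svwAfterDowns 0 x ℕ.+ svwAfterDowns (suc (trailingDowns x)) y
    ≡⟨ cong (svwAfterDowns 0 x ℕ.+_) (svwAfterDowns-Dyck (suc (trailingDowns x)) y dyck) ⟩
  svwAfterDowns 0 x ℕ.+ (svwAfterDowns 0 y ℕ.+ valleyWeight (suc (trailingDowns x)) (leadingUps y))
    ≡⟨ ℕ.+-assoc (svwAfterDowns 0 x) (svwAfterDowns 0 y) _ ⟨
  svwAfterDowns 0 x ℕ.+ svwAfterDowns 0 y ℕ.+ valleyWeight (suc (trailingDowns x)) (leadingUps y)
    ≡⟨ cong₂ (λ a b → a ℕ.+ b ℕ.+ valleyWeight (suc (trailingDowns x)) (leadingUps y))
             (svw-as-svwAfterDowns x) (svw-as-svwAfterDowns y) ⟨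
  svw x ℕ.+ svw y ℕ.+ valleyWeight (suc (trailingDowns x)) (leadingUps y)
    ∎
  where open ≡-Reasoning

trailingDownsFrom-++U : ∀ k x w → trailingDownsFrom k (x ++ U ∷ w) ≡ trailingDowns w
trailingDownsFrom-++U k []      w = refl
trailingDownsFrom-++U k (D ∷ x) w = trailingDownsFrom-++U (suc k) x w
trailingDownsFrom-++U k (U ∷ x) w = trailingDownsFrom-++U 0 x w

trailingDowns-lastReturn : ∀ x x′ → trailingDowns (x ++ U ∷ x′ ++ D ∷ []) ≡ suc (trailingDowns x′)
trailingDowns-lastReturn x x′ = trans (trailingDownsFrom-++U 0 x (x′ ++ D ∷ [])) (trailingDownsFrom-++ 0 x′ [])

+valleyWeight : ∀ t l → + valleyWeight t l ≡ when (t ≡ᵇ l) (+ t)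
+valleyWeight t l with t ≡ᵇ l
... | true  = refl
... | false = refl

matchWeight : ℕ → (ℕ → ℤ) → List Step → List Step → ℤ
matchWeight k ω x y = when (k ℕ.+ trailingDowns x ≡ᵇ leadingUps y) (ω (k ℕ.+ trailingDowns x))

+svw-firstReturn : ∀ x y → isDyck y ≡ true → + svw (U ∷ x ++ D ∷ y) ≡ + svw x + + svw y + matchWeight 1 (λ t → + t) x y
+svw-firstReturn x y dyck = begin
  + svw (U ∷ x ++ D ∷ y)
    ≡⟨ cong +_ (svw-firstReturn x y dyck) ⟩
  + (svw x ℕ.+ svw y ℕ.+ valleyWeight (suc (trailingDowns x)) (leadingUps y))
    ≡⟨ ℤ.pos-+ (svw x ℕ.+ svw y) (valleyWeight (suc (trailingDowns x)) (leadingUps y)) ⟩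
  + (svw x ℕ.+ svw y) + + valleyWeight (suc (trailingDowns x)) (leadingUps y)
    ≡⟨ cong₂ _+_ (ℤ.pos-+ (svw x) (svw y)) (+valleyWeight (suc (trailingDowns x)) (leadingUps y)) ⟩
  + svw x + + svw y + matchWeight 1 (λ t → + t) x y
    ∎
  where open ≡-Reasoning

-- Generating functions

dyckSeries : (List Step → ℤ) → Series
dyckSeries f n = ∑-Dyck n f

catalan : Series
catalan = dyckSeries (λ _ → 1ℤ)

∑-Dyck-const : ∀ n c → ∑[ p ∈Dyck n ] c ≡ c * catalan n
∑-Dyck-const n c = trans (∑-Dyck-cong n (λ _ _ → sym (ℤ.*-identityʳ c))) (∑-Dyck-*ˡ n c (λ _ → 1ℤ))

pairSeries : (List Step → List Step → ℤ) → Series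
pairSeries F n = ∑[ i + j ≡ n ] ∑[ x ∈Dyck i ] ∑[ y ∈Dyck j ] F x y

dyckSeries-firstReturn : ∀ f → dyckSeries f ≈ cst (f []) ⊕ shift (pairSeries (λ x y → f (U ∷ x ++ D ∷ y)))
dyckSeries-firstReturn f zero    = sym (ℤ.+-identityʳ (f []))
dyckSeries-firstReturn f (suc n) = trans (∑-Dyck-firstReturn n f) (sym (ℤ.+-identityˡ _))

pairSeries-cong : ∀ {F G} → (∀ x y → isDyck x ≡ true → isDyck y ≡ true → F x y ≡ G x y) → pairSeries F ≈ pairSeries G
pairSeries-cong F≡G n = ∑⁺-cong n (λ i j → ∑-Dyck-cong i (λ x dx → ∑-Dyck-cong j (λ y dy → F≡G x y dx dy)))

pairSeries-distrib : ∀ F G → pairSeries (λ x y → F x y + G x y) ≈ pairSeries F ⊕ pairSeries G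
pairSeries-distrib F G n = begin
  pairSeries (λ x y → F x y + G x y) n
    ≡⟨ ∑⁺-cong n (λ i j → ∑-Dyck-cong i (λ x _ → ∑-Dyck-distrib-+ j (F x) (G x))) ⟩
  ∑[ i + j ≡ n ] ∑[ x ∈Dyck i ] (∑-Dyck j (F x) + ∑-Dyck j (G x))
    ≡⟨ ∑⁺-cong n (λ i j → ∑-Dyck-distrib-+ i (λ x → ∑-Dyck j (F x)) (λ x → ∑-Dyck j (G x))) ⟩
  ∑[ i + j ≡ n ] (∑[ x ∈Dyck i ] ∑-Dyck j (F x) + ∑[ x ∈Dyck i ] ∑-Dyck j (G x))
    ≡⟨ ∑⁺-distrib-+ n (λ i j → ∑[ x ∈Dyck i ] ∑-Dyck j (F x)) (λ i j → ∑[ x ∈Dyck i ] ∑-Dyck j (G x)) ⟩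
  pairSeries F n + pairSeries G n
    ∎
  where open ≡-Reasoning

pairSeries-⊛ : ∀ f g → pairSeries (λ x y → f x * g y) ≈ dyckSeries f ⊛ dyckSeries g
pairSeries-⊛ f g n = begin
  pairSeries (λ x y → f x * g y) n
    ≡⟨ ∑⁺-cong n (λ i j → ∑-Dyck-cong i (λ x _ → ∑-Dyck-*ˡ j (f x) g)) ⟩
  ∑[ i + j ≡ n ] ∑[ x ∈Dyck i ] (f x * ∑-Dyck j g)
    ≡⟨ ∑⁺-cong n (λ i j → ∑-Dyck-*ʳ i (∑-Dyck j g) f) ⟩
  ∑[ i + j ≡ n ] (∑-Dyck i f * ∑-Dyck j g)
    ≡⟨ ⊛-as-∑⁺ (dyckSeries f) (dyckSeries g) n ⟨
  (dyckSeries f ⊛ dyckSeries g) n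
    ∎
  where open ≡-Reasoning

pairSeries-fst : ∀ f → pairSeries (λ x _ → f x) ≈ dyckSeries f ⊛ catalan
pairSeries-fst f = ≈-trans (pairSeries-cong (λ x _ _ _ → sym (ℤ.*-identityʳ (f x)))) (pairSeries-⊛ f (λ _ → 1ℤ))

pairSeries-snd : ∀ g → pairSeries (λ _ y → g y) ≈ catalan ⊛ dyckSeries g
pairSeries-snd g = ≈-trans (pairSeries-cong (λ _ y _ _ → sym (ℤ.*-identityˡ (g y)))) (pairSeries-⊛ (λ _ → 1ℤ) g)

pairSeries-zero : pairSeries (λ _ _ → 0ℤ) ≈ 𝟘
pairSeries-zero n = trans (∑⁺-cong n (λ i j → trans (∑-Dyck-cong i (λ _ _ → ∑-Dyck-zero j)) (∑-Dyck-zero i))) (∑⁺-zero n)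

pairSeries-firstReturnʳ : ∀ F G → (∀ x y y′ → F x (U ∷ y ++ D ∷ y′) ≡ G x y) →
  pairSeries F ≈ dyckSeries (λ x → F x []) ⊕ shift (pairSeries G ⊛ catalan)
pairSeries-firstReturnʳ F G F≡G zero    = refl
pairSeries-firstReturnʳ F G F≡G (suc n) = begin
  pairSeries F (suc n)
    ≡⟨ ∑⁺-suc-last n (λ i j → ∑[ x ∈Dyck i ] ∑-Dyck j (F x)) ⟩
  ∑[ i + j ≡ n ] ∑[ x ∈Dyck i ] ∑-Dyck (suc j) (F x) + dyckSeries (λ x → F x []) (suc n)
    ≡⟨ ℤ.+-comm (∑[ i + j ≡ n ] ∑[ x ∈Dyck i ] ∑-Dyck (suc j) (F x)) _ ⟩
  dyckSeries (λ x → F x []) (suc n) + ∑[ i + j ≡ n ] ∑[ x ∈Dyck i ] ∑-Dyck (suc j) (F x)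
    ≡⟨ cong (λ t → dyckSeries (λ x → F x []) (suc n) + t) (begin
       ∑[ i + j ≡ n ] ∑[ x ∈Dyck i ] ∑-Dyck (suc j) (F x)
         ≡⟨ ∑⁺-cong n (λ i j → ∑-Dyck-cong i (λ x _ → split-first-y x j)) ⟩
       ∑[ i + j ≡ n ] ∑[ x ∈Dyck i ] ∑[ a + b ≡ j ] (∑-Dyck a (G x) * catalan b)
         ≡⟨ ∑⁺-cong n (λ i j → trans (∑-Dyck-∑⁺ i j (λ a b x → ∑-Dyck a (G x) * catalan b))
                                     (∑⁺-cong j (λ a b → ∑-Dyck-*ʳ i (catalan b) (λ x → ∑-Dyck a (G x))))) ⟩
       ∑[ i + j ≡ n ] ∑[ a + b ≡ j ] (∑[ x ∈Dyck i ] ∑-Dyck a (G x) * catalan b)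
         ≡⟨ ∑⁺-assoc n (λ i a b → ∑[ x ∈Dyck i ] ∑-Dyck a (G x) * catalan b) ⟨
       ∑[ m + b ≡ n ] ∑[ i + a ≡ m ] (∑[ x ∈Dyck i ] ∑-Dyck a (G x) * catalan b)
         ≡⟨ ∑⁺-cong n (λ m b → ∑⁺-*ʳ m (catalan b) (λ i a → ∑[ x ∈Dyck i ] ∑-Dyck a (G x))) ⟩
       ∑[ m + b ≡ n ] (pairSeries G m * catalan b)
         ≡⟨ ⊛-as-∑⁺ (pairSeries G) catalan n ⟨
       (pairSeries G ⊛ catalan) n
         ∎) ⟩
  dyckSeries (λ x → F x []) (suc n) + (pairSeries G ⊛ catalan) n
    ∎
  where
  open ≡-Reasoning
  split-first-y : ∀ x j → ∑-Dyck (suc j) (F x) ≡ ∑[ a + b ≡ j ] (∑-Dyck a (G x) * catalan b)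
  split-first-y x j = trans (∑-Dyck-firstReturn j (F x)) (∑⁺-cong j (λ a b →
    trans (∑-Dyck-cong a (λ y _ → trans (∑-Dyck-cong b (λ y′ _ → F≡G x y y′)) (∑-Dyck-const b (G x y))))
          (∑-Dyck-*ʳ a (catalan b) (G x))))

pairSeries-lastReturnˡ : ∀ F G → (∀ x x′ y → F (x ++ U ∷ x′ ++ D ∷ []) y ≡ G x′ y) →
  pairSeries F ≈ dyckSeries (F []) ⊕ shift (catalan ⊛ pairSeries G)
pairSeries-lastReturnˡ F G F≡G zero    = refl
pairSeries-lastReturnˡ F G F≡G (suc n) = cong (λ t → dyckSeries (F []) (suc n) + t) (begin
  ∑[ i + j ≡ n ] ∑[ x ∈Dyck suc i ] ∑-Dyck j (F x)
    ≡⟨ ∑⁺-cong n (λ i j → split-last-x i j) ⟩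
  ∑[ i + j ≡ n ] ∑[ a + b ≡ i ] (catalan a * ∑[ x′ ∈Dyck b ] ∑-Dyck j (G x′))
    ≡⟨ ∑⁺-assoc n (λ a b j → catalan a * ∑[ x′ ∈Dyck b ] ∑-Dyck j (G x′)) ⟩
  ∑[ a + m ≡ n ] ∑[ b + j ≡ m ] (catalan a * ∑[ x′ ∈Dyck b ] ∑-Dyck j (G x′))
    ≡⟨ ∑⁺-cong n (λ a m → ∑⁺-*ˡ m (catalan a) (λ b j → ∑[ x′ ∈Dyck b ] ∑-Dyck j (G x′))) ⟩
  ∑[ a + m ≡ n ] (catalan a * pairSeries G m)
    ≡⟨ ⊛-as-∑⁺ catalan (pairSeries G) n ⟨
  (catalan ⊛ pairSeries G) n
    ∎)
  where
  open ≡-Reasoning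
  Gs : ℕ → ℕ → ℤ
  Gs b j = ∑[ x′ ∈Dyck b ] ∑-Dyck j (G x′)
  split-last-x : ∀ i j → ∑[ x ∈Dyck suc i ] ∑-Dyck j (F x) ≡ ∑[ a + b ≡ i ] (catalan a * Gs b j)
  split-last-x i j = trans (∑-Dyck-lastReturn i (λ x → ∑-Dyck j (F x))) (∑⁺-cong i (λ a b →
    trans (∑-Dyck-cong a (λ x _ → ∑-Dyck-cong b (λ x′ _ → ∑-Dyck-cong j (λ y _ → F≡G x x′ y))))
          (trans (∑-Dyck-const a (Gs b j)) (ℤ.*-comm (Gs b j) (catalan a)))))

catalan-recurrence : catalan ≈ cst 1ℤ ⊕ z ⊛ (catalan ⊛ catalan)
catalan-recurrence n = trans (dyckSeries-firstReturn (λ _ → 1ℤ) n)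
  (cong (λ t → cst 1ℤ n + t)
        (trans (shift-cong (pairSeries-⊛ (λ _ → 1ℤ) (λ _ → 1ℤ)) n) (shift-as-z⊛ (catalan ⊛ catalan) n)))

svwSeries : Series
svwSeries = dyckSeries (λ p → + svw p)

SVW≈svwSeries : SVW ≈ svwSeries
SVW≈svwSeries n = begin
  + sum (map svw (filterᵇ isDyck (words (2 ℕ.* n))))
    ≡⟨ sum-filter (words (2 ℕ.* n)) ⟩
  sumℤ (map (λ w → when (isDyck w) (+ svw w)) (words (2 ℕ.* n)))
    ≡⟨ sumℤ-words (2 ℕ.* n) _ ⟩
  ∑[ w ∈Word (2 ℕ.* n) ] when (isDyck w) (+ svw w)
    ≡⟨ cong (λ L → ∑[ w ∈Word L ] when (isDyck w) (+ svw w)) (cong (n ℕ.+_) (ℕ.+-identityʳ n)) ⟩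
  ∑[ p ∈Dyck n ] (+ svw p)
    ∎
  where
  open ≡-Reasoning
  sum-filter : ∀ ws → + sum (map svw (filterᵇ isDyck ws)) ≡ sumℤ (map (λ w → when (isDyck w) (+ svw w)) ws)
  sum-filter []       = refl
  sum-filter (w ∷ ws) with isDyck w
  ... | true  = cong (λ t → + svw w + t) (sum-filter ws)
  ... | false = trans (sum-filter ws) (sym (ℤ.+-identityˡ _))

matchSeries : ℕ → (ℕ → ℤ) → Series
matchSeries k ω = pairSeries (matchWeight k ω)

matchCount matchTotal : ℕ → Series
matchCount k = matchSeries k (λ _ → 1ℤ)
matchTotal k = matchSeries k (λ t → + t)

matchSeries-lastReturn : ∀ k ω → matchSeries k ω ≈ dyckSeries (matchWeight k ω []) ⊕ z ⊛ (catalan ⊛ matchSeries (suc k) ω)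
matchSeries-lastReturn k ω n = trans (pairSeries-lastReturnˡ (matchWeight k ω) (matchWeight (suc k) ω) shifted n)
  (cong (λ t → dyckSeries (matchWeight k ω []) n + t) (shift-as-z⊛ (catalan ⊛ matchSeries (suc k) ω) n))
  where
  shifted : ∀ x x′ y → matchWeight k ω (x ++ U ∷ x′ ++ D ∷ []) y ≡ matchWeight (suc k) ω x′ y
  shifted x x′ y rewrite trailingDowns-lastReturn x x′ | ℕ.+-suc k (trailingDowns x′) = refl

matchSeries-firstReturn : ∀ k ω → matchSeries (suc k) ω ≈ z ⊛ (matchSeries k (ω ∘ suc) ⊛ catalan)
matchSeries-firstReturn k ω n = begin
  matchSeries (suc k) ω n
    ≡⟨ pairSeries-firstReturnʳ (matchWeight (suc k) ω) (matchWeight k (ω ∘ suc)) shifted n ⟩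
  ∑[ x ∈Dyck n ] 0ℤ + shift (matchSeries k (ω ∘ suc) ⊛ catalan) n
    ≡⟨ cong (_+ shift (matchSeries k (ω ∘ suc) ⊛ catalan) n) (∑-Dyck-zero n) ⟩
  0ℤ + shift (matchSeries k (ω ∘ suc) ⊛ catalan) n
    ≡⟨ ℤ.+-identityˡ _ ⟩
  shift (matchSeries k (ω ∘ suc) ⊛ catalan) n
    ≡⟨ shift-as-z⊛ (matchSeries k (ω ∘ suc) ⊛ catalan) n ⟩
  (z ⊛ (matchSeries k (ω ∘ suc) ⊛ catalan)) n
    ∎
  where
  open ≡-Reasoning
  shifted : ∀ x y y′ → matchWeight (suc k) ω x (U ∷ y ++ D ∷ y′) ≡ matchWeight k (ω ∘ suc) x y
  shifted x y y′ rewrite leadingUps-++ y y′ = refl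

matchSeries-cong : ∀ k {ω ω′} → (∀ t → ω t ≡ ω′ t) → matchSeries k ω ≈ matchSeries k ω′
matchSeries-cong k ω≡ω′ =
  pairSeries-cong (λ x y _ _ → cong (when (k ℕ.+ trailingDowns x ≡ᵇ leadingUps y)) (ω≡ω′ (k ℕ.+ trailingDowns x)))

matchSeries-distrib : ∀ k ω ω′ → matchSeries k (λ t → ω t + ω′ t) ≈ matchSeries k ω ⊕ matchSeries k ω′
matchSeries-distrib k ω ω′ = ≈-trans (pairSeries-cong split) (pairSeries-distrib (matchWeight k ω) (matchWeight k ω′))
  where
  split : ∀ x y → isDyck x ≡ true → isDyck y ≡ true →
    matchWeight k (λ t → ω t + ω′ t) x y ≡ matchWeight k ω x y + matchWeight k ω′ x y
  split x y _ _ = when-+ (k ℕ.+ trailingDowns x ≡ᵇ leadingUps y) (ω (k ℕ.+ trailingDowns x)) (ω′ (k ℕ.+ trailingDowns x))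

svw-recurrence : svwSeries ≈ z ⊛ (svwSeries ⊛ catalan ⊕ catalan ⊛ svwSeries ⊕ matchTotal 1)
svw-recurrence = begin
  svwSeries
    ≈⟨ dyckSeries-firstReturn (λ p → + svw p) ⟩
  cst 0ℤ ⊕ shift (pairSeries (λ x y → + svw (U ∷ x ++ D ∷ y)))
    ≈⟨ ⊕-cong cst-0 (shift-cong (pairSeries-cong (λ x y _ dy → +svw-firstReturn x y dy))) ⟩
  𝟘 ⊕ shift (pairSeries (λ x y → + svw x + + svw y + matchWeight 1 (λ t → + t) x y))
    ≈⟨ ⊕-identityˡ _ ⟩
  shift (pairSeries (λ x y → + svw x + + svw y + matchWeight 1 (λ t → + t) x y))
    ≈⟨ shift-cong (pairSeries-distrib (λ x y → + svw x + + svw y) (matchWeight 1 (λ t → + t))) ⟩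
  shift (pairSeries (λ x y → + svw x + + svw y) ⊕ matchTotal 1)
    ≈⟨ shift-cong (⊕-cong (pairSeries-distrib (λ x _ → + svw x) (λ _ y → + svw y)) (≈-refl {matchTotal 1})) ⟩
  shift (pairSeries (λ x _ → + svw x) ⊕ pairSeries (λ _ y → + svw y) ⊕ matchTotal 1)
    ≈⟨ shift-cong (⊕-cong (⊕-cong (pairSeries-fst (λ p → + svw p)) (pairSeries-snd (λ p → + svw p))) (≈-refl {matchTotal 1})) ⟩
  shift (svwSeries ⊛ catalan ⊕ catalan ⊛ svwSeries ⊕ matchTotal 1)
    ≈⟨ shift-as-z⊛ (svwSeries ⊛ catalan ⊕ catalan ⊛ svwSeries ⊕ matchTotal 1) ⟩
  z ⊛ (svwSeries ⊛ catalan ⊕ catalan ⊛ svwSeries ⊕ matchTotal 1)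
    ∎
  where open ≈-Reasoning

noLeadingUp≈1 : dyckSeries (λ y → when (0 ≡ᵇ leadingUps y) 1ℤ) ≈ cst 1ℤ
noLeadingUp≈1 = begin
  dyckSeries (λ y → when (0 ≡ᵇ leadingUps y) 1ℤ)  ≈⟨ dyckSeries-firstReturn (λ y → when (0 ≡ᵇ leadingUps y) 1ℤ) ⟩
  cst 1ℤ ⊕ shift (pairSeries (λ _ _ → 0ℤ))        ≈⟨ ⊕-cong (≈-refl {cst 1ℤ}) (shift-cong pairSeries-zero) ⟩
  cst 1ℤ ⊕ shift 𝟘                                ≈⟨ ⊕-cong (≈-refl {cst 1ℤ}) shift-𝟘 ⟩
  cst 1ℤ ⊕ 𝟘                                      ≈⟨ ⊕-identityʳ (cst 1ℤ) ⟩
  cst 1ℤ                                          ∎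
  where open ≈-Reasoning

oneUp : Series
oneUp = dyckSeries (λ y → when (1 ≡ᵇ leadingUps y) 1ℤ)

zC : Series
zC = z ⊛ catalan

oneUp≈zC : oneUp ≈ zC
oneUp≈zC = begin
  dyckSeries (λ y → when (1 ≡ᵇ leadingUps y) 1ℤ)
    ≈⟨ dyckSeries-firstReturn (λ y → when (1 ≡ᵇ leadingUps y) 1ℤ) ⟩
  cst 0ℤ ⊕ shift (pairSeries (λ y y′ → when (0 ≡ᵇ leadingUps (y ++ D ∷ y′)) 1ℤ))
    ≈⟨ ⊕-cong cst-0 (shift-cong (pairSeries-cong (λ y y′ _ _ → cong (λ l → when (0 ≡ᵇ l) 1ℤ) (leadingUps-++ y y′)))) ⟩
  𝟘 ⊕ shift (pairSeries (λ y _ → when (0 ≡ᵇ leadingUps y) 1ℤ))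
    ≈⟨ ⊕-identityˡ _ ⟩
  shift (pairSeries (λ y _ → when (0 ≡ᵇ leadingUps y) 1ℤ))
    ≈⟨ shift-cong (pairSeries-fst (λ y → when (0 ≡ᵇ leadingUps y) 1ℤ)) ⟩
  shift (dyckSeries (λ y → when (0 ≡ᵇ leadingUps y) 1ℤ) ⊛ catalan)
    ≈⟨ shift-cong (⊛-cong noLeadingUp≈1 (≈-refl {catalan})) ⟩
  shift (cst 1ℤ ⊛ catalan)
    ≈⟨ shift-cong (⊛-identityˡ catalan) ⟩
  shift catalan
    ≈⟨ shift-as-z⊛ catalan ⟩
  zC
    ∎
  where open ≈-Reasoning

catalan-quadratic : zC ≈ z ⊕ zC ⊛ zC
catalan-quadratic = ≈-from-⊝
  (solve 2 (λ z C → z :* C :- (z :+ z :* C :* (z :* C)) := z :* (C :- (con 1ℤ :+ z :* (C :* C))) :+ con 0ℤ)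
     (λ _ → refl) z catalan)
  (⊕-vanishing {l = z} catalan-recurrence cst-0)

[1-zC²] : Series
[1-zC²] = cst 1ℤ ⊝ zC ⊛ zC

matchCount-closed : [1-zC²] ⊛ matchCount 1 ≈ zC
matchCount-closed = ≈-from-⊝
  (solve 5 (λ z C K₁ K₂ L →
     (con 1ℤ :- z :* C :* (z :* C)) :* K₁ :- z :* C
       := con 1ℤ :* (K₁ :- (L :+ z :* (C :* K₂)))
          :+ (z :* C :* (K₂ :- z :* (K₁ :* C)) :+ (con 1ℤ :* (L :- z :* C) :+ con 0ℤ)))
     (λ _ → refl) z catalan (matchCount 1) (matchCount 2) oneUp)
  (⊕-vanishing {l = cst 1ℤ} (matchSeries-lastReturn 1 (λ _ → 1ℤ))
  (⊕-vanishing {l = zC} (matchSeries-firstReturn 1 (λ _ → 1ℤ))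
  (⊕-vanishing {l = cst 1ℤ} oneUp≈zC cst-0)))

matchTotal-shifted : matchSeries 1 (λ t → + suc t) ≈ matchCount 1 ⊕ matchTotal 1
matchTotal-shifted = ≈-trans (matchSeries-cong 1 (λ t → ℤ.pos-+ 1 t)) (matchSeries-distrib 1 (λ _ → 1ℤ) (λ t → + t))

matchTotal-closed : [1-zC²] ⊛ matchTotal 1 ≈ zC ⊕ zC ⊛ zC ⊛ matchCount 1
matchTotal-closed = ≈-from-⊝
  (solve 7 (λ z C K₁ M₁ M₁′ M₂ L →
     (con 1ℤ :- z :* C :* (z :* C)) :* M₁ :- (z :* C :+ z :* C :* (z :* C) :* K₁)
       := con 1ℤ :* (M₁ :- (L :+ z :* (C :* M₂)))
          :+ (z :* C :* (M₂ :- z :* (M₁′ :* C))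
          :+ (z :* C :* (z :* C) :* (M₁′ :- (K₁ :+ M₁)) :+ (con 1ℤ :* (L :- z :* C) :+ con 0ℤ))))
     (λ _ → refl) z catalan (matchCount 1) (matchTotal 1) (matchSeries 1 (λ t → + suc t)) (matchTotal 2) oneUp)
  (⊕-vanishing {l = cst 1ℤ} (matchSeries-lastReturn 1 (λ t → + t))
  (⊕-vanishing {l = zC} (matchSeries-firstReturn 1 (λ t → + t))
  (⊕-vanishing {l = zC ⊛ zC} matchTotal-shifted
  (⊕-vanishing {l = cst 1ℤ} oneUp≈zC cst-0))))

√[1-4z] : Series
√[1-4z] = cst 1ℤ ⊝ cst (+ 2) ⊛ zC

svw-closed : √[1-4z] ⊛ [1-zC²] ⊛ [1-zC²] ⊛ svwSeries ≈ z ⊛ zC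
svw-closed = ≈-from-⊝
  (solve 5 (λ z C A K₁ M₁ →
     let w = z :* C
         v = con 1ℤ :- w :* w
     in (con 1ℤ :- con (+ 2) :* w) :* v :* v :* A :- z :* w
          := v :* v :* (A :- z :* (A :* C :+ C :* A :+ M₁))
             :+ (z :* v :* (v :* M₁ :- (w :+ w :* w :* K₁)) :+ (z :* w :* w :* (v :* K₁ :- w) :+ con 0ℤ)))
     (λ _ → refl) z catalan svwSeries (matchCount 1) (matchTotal 1))
  (⊕-vanishing {l = [1-zC²] ⊛ [1-zC²]} svw-recurrence
  (⊕-vanishing {l = z ⊛ [1-zC²]} matchTotal-closed
  (⊕-vanishing {l = z ⊛ zC ⊛ zC} matchCount-closed cst-0)))

√[1-4z]-unique : ∀ S → S 0 ≡ 1ℤ → S ⊛ S ≈ horner (+ 1 ∷ -[1+ 3 ] ∷ []) z → S ≈ √[1-4z]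
√[1-4z]-unique S S₀≡1 S²≈1-4z = square-root-unique S √[1-4z] S₀≡1 refl (≈-trans S²≈1-4z (≈-sym √[1-4z]²))
  where
  √[1-4z]² : √[1-4z] ⊛ √[1-4z] ≈ horner (+ 1 ∷ -[1+ 3 ] ∷ []) z
  √[1-4z]² = ≈-from-⊝
    (solve 2 (λ z w → (con 1ℤ :- con (+ 2) :* w) :* (con 1ℤ :- con (+ 2) :* w) :- hornerₚ (+ 1 ∷ -[1+ 3 ] ∷ []) z
                      := con -[1+ 3 ] :* (w :- (z :+ w :* w)) :+ con 0ℤ)
       (λ _ → refl) z zC)
    (⊕-vanishing {l = cst -[1+ 3 ]} catalan-quadratic cst-0)

P Q R : List ℤ
P = + 1 ∷ -[1+ 2 ] ∷ -[1+ 2 ] ∷ -[1+ 3 ] ∷ []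
Q = + 1 ∷ -[1+ 0 ] ∷ -[1+ 2 ] ∷ []
R = + 0 ∷ + 0 ∷ + 2 ∷ []

z≈zC-zC² : z ≈ zC ⊝ zC ⊛ zC
z≈zC-zC² = ≈-from-⊝
  (solve 2 (λ z w → z :- (w :- w :* w) := con -[1+ 0 ] :* (w :- (z :+ w :* w)) :+ con 0ℤ) (λ _ → refl) z zC)
  (⊕-vanishing {l = cst -[1+ 0 ]} catalan-quadratic cst-0)

P+Q√[1-4z] : horner P z ⊕ horner Q z ⊛ √[1-4z] ≈ cst (+ 2) ⊛ (cst 1ℤ ⊝ zC) ⊛ (√[1-4z] ⊛ [1-zC²] ⊛ [1-zC²])
P+Q√[1-4z] = begin
  horner P z ⊕ horner Q z ⊛ √[1-4z]
    ≈⟨ ⊕-cong (horner-cong P z≈zC-zC²) (⊛-cong (horner-cong Q z≈zC-zC²) (≈-refl {√[1-4z]})) ⟩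
  horner P (zC ⊝ zC ⊛ zC) ⊕ horner Q (zC ⊝ zC ⊛ zC) ⊛ √[1-4z]
    ≈⟨ solve 1 (λ w →
         let v = con 1ℤ :- w :* w
             s = con 1ℤ :- con (+ 2) :* w
         in hornerₚ P (w :- w :* w) :+ hornerₚ Q (w :- w :* w) :* s := con (+ 2) :* (con 1ℤ :- w) :* (s :* v :* v))
         (λ _ → refl) zC ⟩
  cst (+ 2) ⊛ (cst 1ℤ ⊝ zC) ⊛ (√[1-4z] ⊛ [1-zC²] ⊛ [1-zC²])
    ∎
  where open ≈-Reasoning

svw-identity : ∀ S → S 0 ≡ 1ℤ → S ⊛ S ≈ horner (+ 1 ∷ -[1+ 3 ] ∷ []) z →
  svwSeries ⊛ (horner P z ⊕ horner Q z ⊛ S) ≈ horner R z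
svw-identity S S₀≡1 S²≈1-4z = begin
  svwSeries ⊛ (horner P z ⊕ horner Q z ⊛ S)
    ≈⟨ ⊛-cong (≈-refl {svwSeries})
              (⊕-cong (≈-refl {horner P z}) (⊛-cong (≈-refl {horner Q z}) (√[1-4z]-unique S S₀≡1 S²≈1-4z))) ⟩
  svwSeries ⊛ (horner P z ⊕ horner Q z ⊛ √[1-4z])
    ≈⟨ ⊛-cong (≈-refl {svwSeries}) P+Q√[1-4z] ⟩
  svwSeries ⊛ (cst (+ 2) ⊛ (cst 1ℤ ⊝ zC) ⊛ (√[1-4z] ⊛ [1-zC²] ⊛ [1-zC²]))
    ≈⟨ ≈-from-⊝
         (solve 3 (λ z w A →
            let D = (con 1ℤ :- con (+ 2) :* w) :* (con 1ℤ :- w :* w) :* (con 1ℤ :- w :* w)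
            in A :* (con (+ 2) :* (con 1ℤ :- w) :* D) :- hornerₚ R z
                 := con (+ 2) :* (con 1ℤ :- w) :* (D :* A :- z :* w) :+ (con (+ 2) :* z :* (w :- (z :+ w :* w)) :+ con 0ℤ))
            (λ _ → refl) z zC svwSeries)
         (⊕-vanishing {l = cst (+ 2) ⊛ (cst 1ℤ ⊝ zC)} svw-closed
         (⊕-vanishing {l = cst (+ 2) ⊛ z} catalan-quadratic cst-0)) ⟩
  horner R z
    ∎
  where open ≈-Reasoning

corollary3p4 : (S : Series) → S 0 ≡ + 1 → (∀ n → (S ⊛ S) n ≡ poly (+ 1 ∷ -[1+ 3 ] ∷ []) n) → ∀ n → (SVW ⊛ (poly (+ 1 ∷ -[1+ 2 ] ∷ -[1+ 2 ] ∷ -[1+ 3 ] ∷ []) ⊕ poly (+ 1 ∷ -[1+ 0 ] ∷ -[1+ 2 ] ∷ []) ⊛ S)) n ≡ poly (+ 0 ∷ + 0 ∷ + 2 ∷ []) n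
corollary3p4 S S₀≡1 S²≈1-4z = begin
  SVW ⊛ (poly P ⊕ poly Q ⊛ S)
    ≈⟨ ⊛-cong SVW≈svwSeries (⊕-cong (poly-as-horner P) (⊛-cong (poly-as-horner Q) (≈-refl {S}))) ⟩
  svwSeries ⊛ (horner P z ⊕ horner Q z ⊛ S)
    ≈⟨ svw-identity S S₀≡1 (≈-trans S²≈1-4z (poly-as-horner (+ 1 ∷ -[1+ 3 ] ∷ []))) ⟩
  horner R z
    ≈⟨ poly-as-horner R ⟨
  poly R
    ∎
  where open ≈-Reasoning
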